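{- For every $n\ge0$, $$\#\mathrm{Av}_n([1234],[1243],[1324])=\#\mathrm{Av}_n([1234],[1324],[1342])=\#\mathrm{Av}_n([1243],[1423],[1432])=\#\mathrm{Av}_n([1342],[1423],[1432]).$$ Moreover, for $n\ge4$, $\#\mathrm{Av}_n([1234],[1324],[1342])=3$.
   Context: For a linear permutation $\pi=\pi_1\ldots\pi_n$ of $[n]$, the cyclic permutation $[\pi]$ is the set of all rotations of $\pi$. A linear permutation $\sigma$ contains $\pi$ if some subsequence of $\sigma$ is order isomorphic to $\pi$ (same relative order). A cyclic permutation $[\sigma]$ contains $[\pi]$ if some rotation of $\sigma$ contains $\pi$; otherwise it avoids $[\pi]$. For a set of cyclic patterns $[\Pi]$, $\mathrm{Av}_n[\Pi]$ denotes the set of cyclic permutations of length $n$ avoiding every pattern in $[\Pi]$. -}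

module Defs where

open import Data.Nat using (ℕ; _<_)
open import Data.List using (List; []; _∷_; _++_; drop; take; upTo; zip; length)
open import Data.List.Membership.Propositional using (_∈_)
open import Data.List.Relation.Binary.Permutation.Propositional using (_↭_)
open import Data.List.Relation.Binary.Sublist.Propositional using (_⊆_)
open import Data.List.Relation.Unary.All using (All)
open import Data.List.Relation.Unary.Any using (Any)
open import Data.List.Relation.Unary.AllPairs using (AllPairs)
open import Data.Product using (Σ; ∃; _×_; _,_)
open import Function.Bundles using (_⇔_)
open import Relation.Binary.PropositionalEquality using (_≡_)
open import Relation.Nullary using (¬_)

IsPerm : ℕ → List ℕ → Set
IsPerm n σ = σ ↭ upTo n

OrderIso : List ℕ → List ℕ → Set
OrderIso s π = (length s ≡ length π) ×
  (∀ {a b c d} → (a , c) ∈ zip s π → (b , d) ∈ zip s π → ((a < b) ⇔ (c < d)))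

Contains : List ℕ → List ℕ → Set
Contains σ π = Σ (List ℕ) λ s → (s ⊆ σ) × OrderIso s π

rotate : ℕ → List ℕ → List ℕ
rotate k σ = drop k σ ++ take k σ

-- σ and τ represent the same cyclic permutation.
RotEq : List ℕ → List ℕ → Set
RotEq σ τ = ∃ λ k → σ ≡ rotate k τ

CycContains : List ℕ → List ℕ → Set
CycContains σ π = ∃ λ k → Contains (rotate k σ) π

CycAvoidsAll : List (List ℕ) → List ℕ → Set
CycAvoidsAll Π σ = All (λ π → ¬ CycContains σ π) Π

-- #Av_n[Π] = m : there is a list of m linear representatives, pairwise
-- representing distinct cyclic permutations, each a permutation of length n
-- avoiding [Π], and every such permutation is a rotation of one of them.
-- I.e. the set of cyclic permutations Av_n[Π] has exactly m elements.
CountAv : ℕ → List (List ℕ) → ℕ → Set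
CountAv n Π m = Σ (List (List ℕ)) λ reps →
  (length reps ≡ m) ×
  All (λ σ → IsPerm n σ × CycAvoidsAll Π σ) reps ×
  AllPairs (λ σ τ → ¬ RotEq σ τ) reps ×
  (∀ σ → IsPerm n σ → CycAvoidsAll Π σ → Any (RotEq σ) reps)

{-# OPTIONS --safe #-}

-- Rotating the patterns 1234, 1324, 1342 to start with their maximum gives 4123, 4132, 4213.
-- Every cyclic permutation of length n + 1 is [n τ] for a linear permutation τ of length n,
-- and [n τ] avoids these patterns iff [τ] does and τ avoids 123, 132 and 213. For n ≥ 4 each
-- avoiding class has a representative n-1, y, …, d with d < y, and no other rotation of it
-- avoids 123, 132 and 213; so the three classes of length 4 each extend in exactly one way.
-- Reversal and complement carry the class onto the other three, preserving the count.

module Submission where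

open import Defs
open import Data.Empty using (⊥; ⊥-elim)
open import Data.Nat using (ℕ; zero; suc; pred; _+_; _∸_; _<_; _≤_; _≥_; z≤n; s≤s; _<?_; _≤?_)
import Data.Nat.Properties as ℕP
open import Data.List using (List; []; _∷_; [_]; _++_; drop; take; upTo; downFrom; applyUpTo; zip; length; map; reverse)
import Data.List.Properties as LP
open import Data.List.Membership.Propositional using (_∈_; find)
import Data.List.Membership.Propositional.Properties as ∈P
open import Data.List.Relation.Unary.Any using (Any; here; there)
import Data.List.Relation.Unary.Any as Any
import Data.List.Relation.Unary.Any.Properties as AnyP
open import Data.List.Relation.Unary.All using (All; []; _∷_)
import Data.List.Relation.Unary.All as All
import Data.List.Relation.Unary.All.Properties as AllP
open import Data.List.Relation.Unary.AllPairs using (AllPairs; []; _∷_; allPairs?)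
open import Data.List.Relation.Binary.Sublist.Propositional
  using (_⊆_; []; _∷_; _∷ʳ_; ⊆-refl; ⊆-trans)
import Data.List.Relation.Binary.Sublist.Propositional.Properties as ⊆P
open import Data.List.Relation.Binary.Equality.Propositional using (≋⇒≡)
open import Data.List.Relation.Binary.Permutation.Propositional using (_↭_; ↭-refl; ↭-sym; ↭-trans; prep; swap; ↭⇒↭ₛ)
import Data.List.Relation.Binary.Permutation.Propositional.Properties as ↭P
import Data.List.Relation.Binary.Permutation.Setoid.Properties as ↭ₛP
open import Data.List.Relation.Unary.Unique.Propositional using (Unique)
import Data.List.Relation.Unary.Unique.Propositional.Properties as UniqueP
open import Data.Product using (∃; ∃₂; _×_; _,_; proj₁; proj₂)
open import Data.Sum using (_⊎_; inj₁; inj₂; [_,_]′)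
open import Function using (id)
open import Function.Bundles using (_⇔_; mk⇔; Equivalence)
import Function.Properties.Equivalence as ⇔
open import Relation.Binary.PropositionalEquality hiding ([_])
open import Relation.Binary.Definitions using (Tri; tri<; tri≈; tri>)
open import Relation.Nullary using (¬_; ¬?; Dec; yes; no)
open import Relation.Nullary.Decidable using (True; toWitness; from-yes)
import Relation.Nullary.Decidable as Dec
open import Data.List.Membership.DecPropositional (LP.≡-dec ℕP._≟_) using (_∈?_)

<-lit : ∀ {m n} {m<n : True (m <? n)} → m < n
<-lit {m<n = m<n} = toWitness m<n

Rot : List ℕ → List ℕ → Set
Rot x y = ∃₂ λ u v → x ≡ u ++ v × y ≡ v ++ u

Rot-refl : ∀ x → Rot x x
Rot-refl x = [] , x , refl , sym (LP.++-identityʳ x)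

Rot-sym : ∀ {x y} → Rot x y → Rot y x
Rot-sym (u , v , x≡uv , y≡vu) = v , u , y≡vu , x≡uv

++-split : ∀ (v u p q : List ℕ) → v ++ u ≡ p ++ q →
  (∃ λ w → p ≡ v ++ w × u ≡ w ++ q) ⊎ (∃ λ w → v ≡ p ++ w × q ≡ w ++ u)
++-split []      u p       q eq = inj₁ (p , refl , eq)
++-split (a ∷ v) u []      q eq = inj₂ (a ∷ v , refl , sym eq)
++-split (a ∷ v) u (b ∷ p) q eq with refl , eq′ ← LP.∷-injective eq with ++-split v u p q eq′
... | inj₁ (w , p≡vw , u≡wq) = inj₁ (w , cong (a ∷_) p≡vw , u≡wq)
... | inj₂ (w , v≡pw , q≡wu) = inj₂ (w , cong (a ∷_) v≡pw , q≡wu)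

Rot-trans : ∀ {x y z} → Rot x y → Rot y z → Rot x z
Rot-trans (u , v , refl , refl) (p , q , vu≡pq , refl) with ++-split v u p q vu≡pq
... | inj₁ (w , refl , refl) = w , q ++ v , LP.++-assoc w q v , sym (LP.++-assoc q v w)
... | inj₂ (w , refl , refl) = u ++ p , w , sym (LP.++-assoc u p w) , LP.++-assoc w u p

Rot-rotate : ∀ k σ → Rot σ (rotate k σ)
Rot-rotate k σ = take k σ , drop k σ , sym (LP.take++drop≡id k σ) , refl

Rot⇒RotEq : ∀ {σ τ} → Rot τ σ → RotEq σ τ
Rot⇒RotEq (u , v , refl , refl) = length u , cong₂ _++_ (sym (drop-length u)) (sym (take-length u))
  where
  drop-length : ∀ u → drop (length u) (u ++ v) ≡ v
  drop-length []      = refl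
  drop-length (_ ∷ u) = drop-length u
  take-length : ∀ u → take (length u) (u ++ v) ≡ u
  take-length []      = refl
  take-length (a ∷ u) = cong (a ∷_) (take-length u)

RotEq⇒Rot : ∀ {σ τ} → RotEq σ τ → Rot τ σ
RotEq⇒Rot (k , refl) = Rot-rotate k _

length-Rot : ∀ {x y} → Rot x y → length y ≡ length x
length-Rot (u , v , refl , refl) =
  trans (LP.length-++ v) (trans (ℕP.+-comm (length v) (length u)) (sym (LP.length-++ u)))

rotate-≥length : ∀ k (xs : List ℕ) → length xs ≤ k → rotate k xs ≡ xs
rotate-≥length k xs le rewrite LP.drop-all k xs le | LP.take-all k xs le = refl

rotate-map : ∀ (f : ℕ → ℕ) k xs → rotate k (map f xs) ≡ map f (rotate k xs)
rotate-map f k xs rewrite LP.drop-map {f = f} k xs | LP.take-map {f = f} k xs =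
  sym (LP.map-++ f (drop k xs) (take k xs))

Rot-reverse : ∀ {x y} → Rot x y → Rot (reverse x) (reverse y)
Rot-reverse (u , v , refl , refl) = reverse v , reverse u , LP.reverse-++ u v , LP.reverse-++ v u

RotDistinct : List ℕ → List ℕ → Set
RotDistinct σ τ = ¬ RotEq σ τ

rotations : List ℕ → List (List ℕ)
rotations τ = map (λ k → rotate k τ) (upTo (suc (length τ)))

∈-rotations⇔RotEq : ∀ {σ τ} → σ ∈ rotations τ ⇔ RotEq σ τ
∈-rotations⇔RotEq {σ} {τ} = mk⇔ from-∈ to-∈
  where
  from-∈ : σ ∈ rotations τ → RotEq σ τ
  from-∈ σ∈ = let k , _ , σ≡ = ∈P.∈-map⁻ (λ k → rotate k τ) {xs = upTo (suc (length τ))} σ∈ in k , σ≡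
  to-∈ : RotEq σ τ → σ ∈ rotations τ
  to-∈ (k , refl) with k ≤? length τ
  ... | yes k≤ = ∈P.∈-map⁺ (λ k → rotate k τ) (∈P.∈-upTo⁺ (s≤s k≤))
  ... | no  k≰ = subst (_∈ rotations τ)
                   (trans (LP.++-identityʳ τ) (sym (rotate-≥length k τ (ℕP.≰⇒≥ k≰))))
                   (∈P.∈-map⁺ (λ k → rotate k τ) (∈P.∈-upTo⁺ {n = suc (length τ)} {i = 0} (s≤s z≤n)))

Rot⇒∈-rotations : ∀ {τ σ} → Rot τ σ → σ ∈ rotations τ
Rot⇒∈-rotations r = Equivalence.from ∈-rotations⇔RotEq (Rot⇒RotEq r)

RotEq? : ∀ σ τ → Dec (RotEq σ τ)
RotEq? σ τ = Dec.map ∈-rotations⇔RotEq (σ ∈? rotations τ)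

RotDistinct? : ∀ σ τ → Dec (RotDistinct σ τ)
RotDistinct? σ τ = ¬? (RotEq? σ τ)

∈-zip⁻ : ∀ {s π : List ℕ} {a c} → (a , c) ∈ zip s π → a ∈ s × c ∈ π
∈-zip⁻ {_ ∷ _} {_ ∷ _} (here refl) = here refl , here refl
∈-zip⁻ {_ ∷ s} {_ ∷ π} (there m)   = let a∈ , c∈ = ∈-zip⁻ {s} {π} m in there a∈ , there c∈

zip-partnerˡ : ∀ {s π : List ℕ} {a} → length s ≡ length π → a ∈ s → ∃ λ c → (a , c) ∈ zip s π
zip-partnerˡ {_ ∷ _} {c ∷ _} _ (here refl) = c , here refl
zip-partnerˡ {_ ∷ s} {_ ∷ π} l (there m)   =
  let c , m′ = zip-partnerˡ {s} {π} (ℕP.suc-injective l) m in c , there m′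

zip-partnerʳ : ∀ {s π : List ℕ} {c} → length s ≡ length π → c ∈ π → ∃ λ a → (a , c) ∈ zip s π
zip-partnerʳ {a ∷ _} {_ ∷ _} _ (here refl) = a , here refl
zip-partnerʳ {_ ∷ s} {_ ∷ π} l (there m)   =
  let a , m′ = zip-partnerʳ {s} {π} (ℕP.suc-injective l) m in a , there m′

zip-++ : ∀ (xs ys xs′ ys′ : List ℕ) → length xs ≡ length ys →
         zip (xs ++ xs′) (ys ++ ys′) ≡ zip xs ys ++ zip xs′ ys′
zip-++ []       []       _ _ _ = refl
zip-++ (x ∷ xs) (y ∷ ys) _ _ l = cong ((x , y) ∷_) (zip-++ xs ys _ _ (ℕP.suc-injective l))

OrderIso-restrict : ∀ {s π s′ π′} → length s′ ≡ length π′ →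
  (∀ {p} → p ∈ zip s′ π′ → p ∈ zip s π) → OrderIso s π → OrderIso s′ π′
OrderIso-restrict l sub (_ , iso) = l , λ m₁ m₂ → iso (sub m₁) (sub m₂)

OrderIso-tail : ∀ {x p s π} → OrderIso (x ∷ s) (p ∷ π) → OrderIso s π
OrderIso-tail iso = OrderIso-restrict (ℕP.suc-injective (proj₁ iso)) there iso

OrderIso-∷-max : ∀ {x p s π} → All (_< x) s → All (_< p) π → OrderIso s π → OrderIso (x ∷ s) (p ∷ π)
OrderIso-∷-max {x} {p} {s} {π} s<x π<p (l , iso) = cong suc l , iso′
  where
  below : ∀ {a c} → (a , c) ∈ zip s π → a < x × c < p
  below m = let a∈ , c∈ = ∈-zip⁻ {s} {π} m in All.lookup s<x a∈ , All.lookup π<p c∈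
  iso′ : ∀ {a b c d} → (a , c) ∈ zip (x ∷ s) (p ∷ π) → (b , d) ∈ zip (x ∷ s) (p ∷ π) → (a < b) ⇔ (c < d)
  iso′ (here refl) (here refl) = mk⇔ (λ x<x → ⊥-elim (ℕP.<-irrefl refl x<x)) (λ p<p → ⊥-elim (ℕP.<-irrefl refl p<p))
  iso′ (here refl) (there m)   = let b<x , d<p = below m in
    mk⇔ (λ x<b → ⊥-elim (ℕP.<-asym x<b b<x)) (λ p<d → ⊥-elim (ℕP.<-asym p<d d<p))
  iso′ (there m)   (here refl) = let a<x , c<p = below m in mk⇔ (λ _ → c<p) (λ _ → a<x)
  iso′ (there m)   (there m′)  = iso m m′

OrderIso-map-increasing : ∀ (f : ℕ → ℕ) π → (∀ {c d} → c ∈ π → d ∈ π → c < d → f c < f d) →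
  OrderIso (map f π) π
OrderIso-map-increasing f π mono = LP.length-map f π , iso
  where
  ∈-zip-map : ∀ {π a c} → (a , c) ∈ zip (map f π) π → a ≡ f c × c ∈ π
  ∈-zip-map {_ ∷ _} (here refl) = refl , here refl
  ∈-zip-map {_ ∷ _} (there m)   = let a≡fc , c∈ = ∈-zip-map m in a≡fc , there c∈
  iso : ∀ {a b c d} → (a , c) ∈ zip (map f π) π → (b , d) ∈ zip (map f π) π → (a < b) ⇔ (c < d)
  iso {c = c} {d = d} m₁ m₂ with ∈-zip-map m₁ | ∈-zip-map m₂
  ... | refl , c∈ | refl , d∈ = mk⇔ reflect (mono c∈ d∈)
    where
    reflect : f c < f d → c < d
    reflect fc<fd with ℕP.<-cmp c d
    ... | tri< c<d _ _ = c<d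
    ... | tri≈ _ refl _ = ⊥-elim (ℕP.<-irrefl refl fc<fd)
    ... | tri> _ _ d<c = ⊥-elim (ℕP.<-asym fc<fd (mono d∈ c∈ d<c))

OrderIso-map-antitone : ∀ {s π} (f g : ℕ → ℕ) →
  (∀ {a b} → a ∈ s → b ∈ s → (a < b) ⇔ (f b < f a)) →
  (∀ {c d} → c ∈ π → d ∈ π → (c < d) ⇔ (g d < g c)) →
  OrderIso s π → OrderIso (map f s) (map g π)
OrderIso-map-antitone {s} {π} f g f-anti g-anti (l , iso) =
  trans (LP.length-map f s) (trans l (sym (LP.length-map g π))) , iso′
  where
  iso′ : ∀ {a′ b′ c′ d′} → (a′ , c′) ∈ zip (map f s) (map g π) → (b′ , d′) ∈ zip (map f s) (map g π) →
         (a′ < b′) ⇔ (c′ < d′)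
  iso′ m₁ m₂ with ∈P.∈-map⁻ _ (subst (_ ∈_) (LP.zip-map f g s π) m₁)
                | ∈P.∈-map⁻ _ (subst (_ ∈_) (LP.zip-map f g s π) m₂)
  ... | (a , c) , n₁ , refl | (b , d) , n₂ , refl =
    let a∈ , c∈ = ∈-zip⁻ {s} {π} n₁ ; b∈ , d∈ = ∈-zip⁻ {s} {π} n₂ in
    ⇔.trans (⇔.sym (f-anti b∈ a∈)) (⇔.trans (iso n₂ n₁) (g-anti d∈ c∈))

OrderIso-reverse : ∀ {s π} → OrderIso s π → OrderIso (reverse s) (reverse π)
OrderIso-reverse {s} {π} iso@(l , _) =
  OrderIso-restrict (trans (LP.length-reverse s) (trans l (sym (LP.length-reverse π))))
    (λ m → AnyP.reverse⁻ (subst (_ ∈_) (zip-reverse s π l) m)) iso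
  where
  zip-reverse : ∀ (xs ys : List ℕ) → length xs ≡ length ys → zip (reverse xs) (reverse ys) ≡ reverse (zip xs ys)
  zip-reverse []       []       _ = refl
  zip-reverse (x ∷ xs) (y ∷ ys) l = begin
    zip (reverse (x ∷ xs)) (reverse (y ∷ ys))
      ≡⟨ cong₂ zip (LP.unfold-reverse x xs) (LP.unfold-reverse y ys) ⟩
    zip (reverse xs ++ [ x ]) (reverse ys ++ [ y ])
      ≡⟨ zip-++ (reverse xs) (reverse ys) [ x ] [ y ] length-reverse-≡ ⟩
    zip (reverse xs) (reverse ys) ++ [ (x , y) ]
      ≡⟨ cong (_++ [ (x , y) ]) (zip-reverse xs ys (ℕP.suc-injective l)) ⟩
    reverse (zip xs ys) ++ [ (x , y) ]
      ≡⟨ sym (LP.unfold-reverse (x , y) (zip xs ys)) ⟩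
    reverse ((x , y) ∷ zip xs ys) ∎
    where
    open ≡-Reasoning
    length-reverse-≡ : length (reverse xs) ≡ length (reverse ys)
    length-reverse-≡ = trans (LP.length-reverse xs) (trans (ℕP.suc-injective l) (sym (LP.length-reverse ys)))

-- Cyclic containment

∷⊆-split : ∀ {s y : List ℕ} {b} → (b ∷ s) ⊆ y → ∃₂ λ y₁ y₂ → y ≡ y₁ ++ b ∷ y₂ × s ⊆ y₂
∷⊆-split (c ∷ʳ sub) = let y₁ , y₂ , eq , s⊆ = ∷⊆-split sub in c ∷ y₁ , y₂ , cong (c ∷_) eq , s⊆
∷⊆-split (refl ∷ s⊆) = [] , _ , refl , s⊆

⊆-split-at : ∀ (A : List ℕ) {x B s} → s ⊆ A ++ x ∷ B →
  (s ⊆ A ++ B) ⊎ (∃₂ λ s₁ s₂ → s ≡ s₁ ++ x ∷ s₂ × s₁ ⊆ A × s₂ ⊆ B)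
⊆-split-at []      (_ ∷ʳ sub)    = inj₁ sub
⊆-split-at []      (refl ∷ sub)  = inj₂ ([] , _ , refl , [] , sub)
⊆-split-at (a ∷ A) (_ ∷ʳ sub)    with ⊆-split-at A sub
... | inj₁ s⊆                       = inj₁ (a ∷ʳ s⊆)
... | inj₂ (s₁ , s₂ , eq , ⊆A , ⊆B) = inj₂ (s₁ , s₂ , eq , a ∷ʳ ⊆A , ⊆B)
⊆-split-at (a ∷ A) (refl ∷ sub)  with ⊆-split-at A sub
... | inj₁ s⊆                       = inj₁ (refl ∷ s⊆)
... | inj₂ (s₁ , s₂ , eq , ⊆A , ⊆B) = inj₂ (a ∷ s₁ , s₂ , cong (a ∷_) eq , refl ∷ ⊆A , ⊆B)

CycContains-Rot : ∀ {σ y π} → Rot σ y → Contains y π → CycContains σ π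
CycContains-Rot r c with k , refl ← Rot⇒RotEq r = k , c

CycContains-resp-Rot : ∀ {σ σ′ π} → Rot σ σ′ → CycContains σ′ π → CycContains σ π
CycContains-resp-Rot r (k , c) = CycContains-Rot (Rot-trans r (Rot-rotate k _)) c

CycAvoidsAll-resp-Rot : ∀ {Π σ σ′} → Rot σ σ′ → CycAvoidsAll Π σ → CycAvoidsAll Π σ′
CycAvoidsAll-resp-Rot r = All.map (λ ¬c c → ¬c (CycContains-resp-Rot r c))

CycContains-rotate₁ : ∀ {σ a π} → CycContains σ (a ∷ π) → CycContains σ (π ++ [ a ])
CycContains-rotate₁ (k , [] , _ , () , _)
CycContains-rotate₁ {σ} {a} {π} (k , b ∷ s , sub , iso) with ∷⊆-split sub
... | y₁ , y₂ , eq , s⊆y₂ =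
  CycContains-Rot (Rot-trans (Rot-rotate k σ) r) (s ++ [ b ] , ⊆P.++⁺ s⊆y₂ (⊆P.++⁺ˡ y₁ ⊆-refl) , iso′)
  where
  r : Rot (rotate k σ) (y₂ ++ y₁ ++ [ b ])
  r = y₁ ++ [ b ] , y₂ , trans eq (sym (LP.++-assoc y₁ [ b ] y₂)) , refl
  l : length s ≡ length π
  l = ℕP.suc-injective (proj₁ iso)
  iso′ : OrderIso (s ++ [ b ]) (π ++ [ a ])
  iso′ = OrderIso-restrict (trans (LP.length-++ s) (trans (cong (_+ 1) l) (sym (LP.length-++ π))))
           (λ m → AnyP.++-comm (zip s π) [ (b , a) ] (subst (_ ∈_) (zip-++ s π [ b ] [ a ] l) m)) iso

CycContains-Rot-pattern : ∀ {σ π π′} → Rot π π′ → CycContains σ π → CycContains σ π′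
CycContains-Rot-pattern {σ} (u , v , refl , refl) = go u v
  where
  go : ∀ u v → CycContains σ (u ++ v) → CycContains σ (v ++ u)
  go []      v h = subst (CycContains σ) (sym (LP.++-identityʳ v)) h
  go (a ∷ u) v h = subst (CycContains σ) (LP.++-assoc v [ a ] u)
    (go u (v ++ [ a ]) (subst (CycContains σ) (LP.++-assoc u v [ a ]) (CycContains-rotate₁ h)))

CycContains-length : ∀ {σ π} → CycContains σ π → length π ≤ length σ
CycContains-length {σ} {π} (k , s , sub , l , _) = begin
  length π             ≡⟨ sym l ⟩
  length s             ≤⟨ ⊆P.length-mono-≤ sub ⟩
  length (rotate k σ)  ≡⟨ length-Rot (Rot-rotate k σ) ⟩
  length σ             ∎
  where open ℕP.≤-Reasoning

CycContains-∷ : ∀ {x τ π} → CycContains τ π → CycContains (x ∷ τ) π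
CycContains-∷ {x} (k , s , sub , iso) = suc k , s , ⊆-trans sub (⊆P.++⁺ ⊆-refl (x ∷ʳ ⊆-refl)) , iso

Contains⇒CycContains-∷-max : ∀ {x τ p π} → All (_< x) τ → All (_< p) π →
  Contains τ π → CycContains (x ∷ τ) (p ∷ π)
Contains⇒CycContains-∷-max τ<x π<p (s , sub , iso) =
  0 , _ ∷ s , refl ∷ ⊆P.++⁺ʳ [] sub , OrderIso-∷-max (⊆P.All-resp-⊆ sub τ<x) π<p iso

-- x cannot play a later entry of p ∷ π, all of which lie below p.
CycContains-∷-max⁻ : ∀ {x τ p π} → All (_< x) τ → All (_< p) π →
  CycContains (x ∷ τ) (p ∷ π) → CycContains τ (p ∷ π) ⊎ Contains τ π
CycContains-∷-max⁻ _ _ (zero , s , _ ∷ʳ sub , iso) = inj₁ (0 , s , sub , iso)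
CycContains-∷-max⁻ {τ = τ} _ _ (zero , _ ∷ s , refl ∷ sub , iso) =
  inj₂ (s , subst (s ⊆_) (LP.++-identityʳ τ) sub , OrderIso-tail iso)
CycContains-∷-max⁻ {x} {τ} {π = π} τ<x π<p (suc k , s , sub , iso) with ⊆-split-at (drop k τ) sub
... | inj₁ sub′ = inj₁ (k , s , sub′ , iso)
... | inj₂ ([] , s₂ , refl , _ , s₂⊆) = inj₂ (s₂ , ⊆-trans s₂⊆ (⊆P.take-⊆ k τ) , OrderIso-tail iso)
... | inj₂ (a ∷ s₁ , s₂ , refl , a∷s₁⊆ , _) with q , m ← zip-partnerˡ {s₁ ++ x ∷ s₂} {π}
                                                  (ℕP.suc-injective (proj₁ iso)) (∈P.∈-++⁺ʳ s₁ (here refl)) =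
  ⊥-elim (ℕP.<-asym (Equivalence.to (proj₂ iso (here refl) (there m)) a<x)
                    (All.lookup π<p (proj₂ (∈-zip⁻ {s₁ ++ x ∷ s₂} {π} m))))
  where
  a<x : a < x
  a<x = All.lookup (AllP.drop⁺ k τ<x) (⊆P.Any-resp-⊆ a∷s₁⊆ (here refl))

Contains-∷-max⁻ : ∀ {x l p π} → All (_< x) l → Any (p <_) π → Contains (x ∷ l) (p ∷ π) → Contains l (p ∷ π)
Contains-∷-max⁻ _ _ (s , _ ∷ʳ sub , iso) = s , sub , iso
Contains-∷-max⁻ {π = π} l<x p<π (_ ∷ s , refl ∷ sub , iso)
  with q , q∈ , p<q ← find p<π
  with y , m ← zip-partnerʳ {s} {π} (ℕP.suc-injective (proj₁ iso)) q∈ =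
  ⊥-elim (ℕP.<-asym (Equivalence.from (proj₂ iso (here refl) (there m)) p<q)
                    (All.lookup (⊆P.All-resp-⊆ sub l<x) (proj₁ (∈-zip⁻ {s} {π} m))))

LinAvoidsAll : List (List ℕ) → List ℕ → Set
LinAvoidsAll Λ τ = All (λ π → ¬ Contains τ π) Λ

CycAvoidsAll-∷-max : ∀ {x τ p Λ} → All (_< x) τ → All (All (_< p)) Λ →
  CycAvoidsAll (map (p ∷_) Λ) (x ∷ τ) ⇔ (CycAvoidsAll (map (p ∷_) Λ) τ × LinAvoidsAll Λ τ)
CycAvoidsAll-∷-max {x} {τ} {p} {Λ} τ<x Λ<p = mk⇔ to from
  where
  to : CycAvoidsAll (map (p ∷_) Λ) (x ∷ τ) → CycAvoidsAll (map (p ∷_) Λ) τ × LinAvoidsAll Λ τ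
  to avoid = AllP.map⁺ (All.tabulate λ π∈ c → All.lookup avoid′ π∈ (CycContains-∷ c))
           , All.tabulate λ π∈ c → All.lookup avoid′ π∈ (Contains⇒CycContains-∷-max τ<x (All.lookup Λ<p π∈) c)
    where
    avoid′ : All (λ π → ¬ CycContains (x ∷ τ) (p ∷ π)) Λ
    avoid′ = AllP.map⁻ avoid
  from : CycAvoidsAll (map (p ∷_) Λ) τ × LinAvoidsAll Λ τ → CycAvoidsAll (map (p ∷_) Λ) (x ∷ τ)
  from (avoid , lin) = AllP.map⁺ (All.tabulate λ π∈ c →
    [ All.lookup (AllP.map⁻ avoid) π∈ , All.lookup lin π∈ ]′ (CycContains-∷-max⁻ τ<x (All.lookup Λ<p π∈) c))

HeadNotMax : List ℕ → Set
HeadNotMax π = ∃₂ λ p π′ → π ≡ p ∷ π′ × Any (p <_) π′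

LinAvoidsAll-∷-max : ∀ {x l Λ} → All (_< x) l → All HeadNotMax Λ → LinAvoidsAll Λ l → LinAvoidsAll Λ (x ∷ l)
LinAvoidsAll-∷-max {x} {l} l<x heads lin = All.tabulate λ π∈ → avoid (All.lookup heads π∈) (All.lookup lin π∈)
  where
  avoid : ∀ {π} → HeadNotMax π → ¬ Contains l π → ¬ Contains (x ∷ l) π
  avoid (_ , _ , refl , p<π) ¬c c = ¬c (Contains-∷-max⁻ l<x p<π c)

IsPerm-bounded : ∀ {n τ} → IsPerm n τ → All (_< n) τ
IsPerm-bounded p = ↭P.All-resp-↭ (↭-sym p) (All.tabulate ∈P.∈-upTo⁻)

IsPerm-unique : ∀ {n τ} → IsPerm n τ → Unique τ
IsPerm-unique {n} p = ↭ₛP.Unique-resp-↭ (setoid ℕ) (↭⇒↭ₛ (↭-sym p)) (UniqueP.upTo⁺ n)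

upTo-suc : ∀ n → upTo (suc n) ↭ n ∷ upTo n
upTo-suc n = ↭-sym (subst (n ∷ upTo n ↭_) (LP.upTo-∷ʳ n) (↭P.∷↭∷ʳ n (upTo n)))

IsPerm-∷ : ∀ {m τ} → IsPerm m τ → IsPerm (suc m) (m ∷ τ)
IsPerm-∷ {m} p = ↭-trans (prep m p) (↭-sym (upTo-suc m))

IsPerm-∷⁻ : ∀ {m τ} → IsPerm (suc m) (m ∷ τ) → IsPerm m τ
IsPerm-∷⁻ {m} p = ↭P.drop-∷ (↭-trans p (upTo-suc m))

IsPerm-rotate-max-first : ∀ {n σ} → IsPerm (suc n) σ → ∃ λ τ → Rot σ (n ∷ τ) × IsPerm n τ
IsPerm-rotate-max-first {n} {σ} p with u , v , refl ← ∈P.∈-∃++ (↭P.∈-resp-↭ (↭-sym p) (∈P.∈-upTo⁺ (ℕP.n<1+n n))) =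
  v ++ u , (u , n ∷ v , refl , refl) , IsPerm-∷⁻ p′
  where
  p′ : IsPerm (suc n) (n ∷ v ++ u)
  p′ = ↭-trans (prep n (↭P.++-comm v u)) (↭-trans (↭-sym (↭P.shift n u v)) p)

-- Symmetries

record PermSymmetry (n : ℕ) : Set where
  field
    act            : List ℕ → List ℕ
    act-IsPerm     : ∀ {σ} → IsPerm n σ → IsPerm n (act σ)
    act-involutive : ∀ {σ} → IsPerm n σ → act (act σ) ≡ σ
    act-RotEq      : ∀ {σ τ} → RotEq σ τ → RotEq (act σ) (act τ)

CountAv-transport : ∀ {n Π Π′ m} (f : PermSymmetry n) → let open PermSymmetry f in
  (∀ {σ} → IsPerm n σ → CycAvoidsAll Π σ → CycAvoidsAll Π′ (act σ)) →
  (∀ {σ} → IsPerm n σ → CycAvoidsAll Π′ σ → CycAvoidsAll Π (act σ)) →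
  CountAv n Π m → CountAv n Π′ m
CountAv-transport {n} {Π} {Π′} f to from (reps , len , good , distinct , complete) =
  map act reps , trans (LP.length-map act reps) len ,
  AllP.map⁺ (All.map (λ (p , a) → act-IsPerm p , to p a) good) , distinct′ good distinct , complete′
  where
  open PermSymmetry f
  distinct′ : ∀ {rs} → All (λ σ → IsPerm n σ × CycAvoidsAll Π σ) rs → AllPairs RotDistinct rs →
              AllPairs RotDistinct (map act rs)
  distinct′ []               []          = []
  distinct′ ((pσ , _) ∷ good) (ne ∷ ps) =
    AllP.map⁺ (All.zipWith (λ (¬e , pτ , _) e → ¬e (subst₂ RotEq (act-involutive pσ) (act-involutive pτ) (act-RotEq e)))
                           (ne , good))
    ∷ distinct′ good ps
  complete′ : ∀ σ → IsPerm n σ → CycAvoidsAll Π′ σ → Any (RotEq σ) (map act reps)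
  complete′ σ p a = AnyP.map⁺ (Any.map (λ e → subst (λ x → RotEq x _) (act-involutive p) (act-RotEq e))
                                       (complete (act σ) (act-IsPerm p) (from p a)))

Covers : (List ℕ → List ℕ) → List (List ℕ) → List (List ℕ) → Set
Covers g Π Π′ = All (λ π′ → Any (λ π → RotEq π (g π′)) Π) Π′

Covers? : ∀ g Π Π′ → Dec (Covers g Π Π′)
Covers? g Π Π′ = All.all? (λ π′ → Any.any? (λ π → RotEq? π (g π′)) Π) Π′

CycAvoidsAll-transfer : ∀ {Π Π′ σ σ′} (g : List ℕ → List ℕ) →
  (∀ {π′} → π′ ∈ Π′ → CycContains σ′ π′ → CycContains σ (g π′)) →
  Covers g Π Π′ → CycAvoidsAll Π σ → CycAvoidsAll Π′ σ′
CycAvoidsAll-transfer g transfer cover avoid = All.tabulate λ π′∈ c →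
  let _ , π∈ , π≈gπ′ = find (All.lookup cover π′∈) in
  All.lookup avoid π∈ (CycContains-Rot-pattern (RotEq⇒Rot π≈gπ′) (transfer π′∈ c))

CycAvoidsAll-rotate-patterns : ∀ {Π Π′ σ} → Covers id Π Π′ → CycAvoidsAll Π σ → CycAvoidsAll Π′ σ
CycAvoidsAll-rotate-patterns = CycAvoidsAll-transfer id (λ _ c → c)

CycContains-reverse : ∀ {σ π} → CycContains σ π → CycContains (reverse σ) (reverse π)
CycContains-reverse {σ} (k , s , sub , iso) =
  CycContains-Rot (Rot-reverse (Rot-rotate k σ)) (reverse s , ⊆P.reverse⁺ sub , OrderIso-reverse iso)

reversal : ∀ n → PermSymmetry n
reversal n = record
  { act            = reverse
  ; act-IsPerm     = ↭-trans (↭P.↭-reverse _)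
  ; act-involutive = λ {σ} _ → LP.reverse-involutive σ
  ; act-RotEq      = λ e → Rot⇒RotEq (Rot-reverse (RotEq⇒Rot e))
  }

CountAv-reverse : ∀ {n Π Π′ m} → Covers reverse Π Π′ → Covers reverse Π′ Π → CountAv n Π m → CountAv n Π′ m
CountAv-reverse {n} cover cover′ = CountAv-transport (reversal n) (λ _ → avoid cover) (λ _ → avoid cover′)
  where
  avoid : ∀ {Π Π′ σ} → Covers reverse Π Π′ → CycAvoidsAll Π σ → CycAvoidsAll Π′ (reverse σ)
  avoid {σ = σ} = CycAvoidsAll-transfer reverse
    (λ _ c → subst (λ x → CycContains x _) (LP.reverse-involutive σ) (CycContains-reverse c))

complement : ℕ → List ℕ → List ℕ
complement n = map (pred n ∸_)

∸-antitone-< : ∀ {m a b} → a ≤ m → b ≤ m → (a < b) ⇔ (m ∸ b < m ∸ a)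
∸-antitone-< {m} {a} {b} a≤m b≤m = mk⇔ (λ a<b → ℕP.∸-monoʳ-< a<b b≤m) reflect
  where
  reflect : m ∸ b < m ∸ a → a < b
  reflect m∸b<m∸a with a <? b
  ... | yes a<b = a<b
  ... | no  a≮b = ⊥-elim (ℕP.<-irrefl refl (ℕP.<-≤-trans m∸b<m∸a (ℕP.∸-monoʳ-≤ m (ℕP.≮⇒≥ a≮b))))

complement-upTo : ∀ n → complement n (upTo n) ↭ upTo n
complement-upTo zero    = ↭-refl
complement-upTo (suc m) =
  subst (_↭ upTo (suc m)) (trans (LP.reverse-upTo (suc m)) (sym (map-∸-upTo m))) (↭P.↭-reverse (upTo (suc m)))
  where
  map-∸-upTo : ∀ m → map (m ∸_) (upTo (suc m)) ≡ downFrom (suc m)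
  map-∸-upTo zero    = refl
  map-∸-upTo (suc m) = cong (suc m ∷_) (begin
    map (suc m ∸_) (applyUpTo suc (suc m))  ≡⟨ cong (map (suc m ∸_)) (LP.map-upTo suc (suc m)) ⟨
    map (suc m ∸_) (map suc (upTo (suc m))) ≡⟨ LP.map-∘ (upTo (suc m)) ⟨
    map (m ∸_) (upTo (suc m))               ≡⟨ map-∸-upTo m ⟩
    downFrom (suc m)                        ∎)
    where open ≡-Reasoning

complementation : ∀ n → PermSymmetry n
complementation n = record
  { act            = complement n
  ; act-IsPerm     = λ p → ↭-trans (↭P.map⁺ (pred n ∸_) p) (complement-upTo n)
  ; act-involutive = involutive
  ; act-RotEq      = λ { (k , refl) → k , sym (rotate-map (pred n ∸_) k _) }
  }
  where
  involutive : ∀ {σ} → IsPerm n σ → complement n (complement n σ) ≡ σ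
  involutive {σ} p = trans (sym (LP.map-∘ σ))
    (LP.map-id-local (All.map (λ x<n → ℕP.m∸[m∸n]≡n (ℕP.<⇒≤pred x<n)) (IsPerm-bounded p)))

CycContains-complement : ∀ {n b σ π} → All (_< n) σ → All (_≤ b) π →
  CycContains σ π → CycContains (complement n σ) (map (b ∸_) π)
CycContains-complement {n} {b} {σ} σ<n π≤b (k , s , sub , iso) =
  k , complement n s ,
  subst (complement n s ⊆_) (sym (rotate-map (pred n ∸_) k σ)) (⊆P.map⁺ (pred n ∸_) sub) ,
  OrderIso-map-antitone (pred n ∸_) (b ∸_)
    (λ a∈ b∈ → ∸-antitone-< (ℕP.<⇒≤pred (All.lookup s<n a∈)) (ℕP.<⇒≤pred (All.lookup s<n b∈)))
    (λ c∈ d∈ → ∸-antitone-< (All.lookup π≤b c∈) (All.lookup π≤b d∈)) iso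
  where
  s<n : All (_< n) s
  s<n = ⊆P.All-resp-⊆ sub (AllP.++⁺ (AllP.drop⁺ k σ<n) (AllP.take⁺ k σ<n))

CountAv-complement : ∀ {n Π Π′ m} b → All (All (_≤ b)) Π → All (All (_≤ b)) Π′ →
  Covers (map (b ∸_)) Π Π′ → Covers (map (b ∸_)) Π′ Π → CountAv n Π m → CountAv n Π′ m
CountAv-complement {n} b Π≤b Π′≤b cover cover′ =
  CountAv-transport (complementation n) (avoid Π′≤b cover) (avoid Π≤b cover′)
  where
  open PermSymmetry (complementation n)
  avoid : ∀ {Π Π′ σ} → All (All (_≤ b)) Π′ → Covers (map (b ∸_)) Π Π′ →
          IsPerm n σ → CycAvoidsAll Π σ → CycAvoidsAll Π′ (complement n σ)
  avoid Π′≤b cover p = CycAvoidsAll-transfer (map (b ∸_))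
    (λ π′∈ c → subst (λ x → CycContains x _) (act-involutive p)
                     (CycContains-complement (IsPerm-bounded (act-IsPerm p)) (All.lookup Π′≤b π′∈) c))
    cover

-- The class Av[1234, 1324, 1342]

Π₁ Π₂ Π₃ Π₄ : List (List ℕ)
Π₁ = (1 ∷ 2 ∷ 3 ∷ 4 ∷ []) ∷ (1 ∷ 2 ∷ 4 ∷ 3 ∷ []) ∷ (1 ∷ 3 ∷ 2 ∷ 4 ∷ []) ∷ []
Π₂ = (1 ∷ 2 ∷ 3 ∷ 4 ∷ []) ∷ (1 ∷ 3 ∷ 2 ∷ 4 ∷ []) ∷ (1 ∷ 3 ∷ 4 ∷ 2 ∷ []) ∷ []
Π₃ = (1 ∷ 2 ∷ 4 ∷ 3 ∷ []) ∷ (1 ∷ 4 ∷ 2 ∷ 3 ∷ []) ∷ (1 ∷ 4 ∷ 3 ∷ 2 ∷ []) ∷ []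
Π₄ = (1 ∷ 3 ∷ 4 ∷ 2 ∷ []) ∷ (1 ∷ 4 ∷ 2 ∷ 3 ∷ []) ∷ (1 ∷ 4 ∷ 3 ∷ 2 ∷ []) ∷ []

-- The patterns of Π₂ rotated to begin with their maximum 4 are 4 ∷ π for π ∈ Λ.
Λ : List (List ℕ)
Λ = (1 ∷ 2 ∷ 3 ∷ []) ∷ (1 ∷ 3 ∷ 2 ∷ []) ∷ (2 ∷ 1 ∷ 3 ∷ []) ∷ []

Λ-bounded : All (All (_< 4)) Λ
Λ-bounded = from-yes (All.all? (All.all? (_<? 4)) Λ)

Λ-HeadNotMax : All HeadNotMax Λ
Λ-HeadNotMax = (_ , _ , refl , here <-lit) ∷ (_ , _ , refl , here <-lit) ∷ (_ , _ , refl , there (here <-lit)) ∷ []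

Contains-map-increasing : ∀ {L} (f : ℕ → ℕ) π → (∀ {c d} → c ∈ π → d ∈ π → c < d → f c < f d) →
  map f π ⊆ L → Contains L π
Contains-map-increasing f π mono sub = map f π , sub , OrderIso-map-increasing f π mono

¬LinAvoidsAll-Λ : ∀ {L π} → π ∈ Λ → (f : ℕ → ℕ) → f 1 < f 2 → f 2 < f 3 → map f π ⊆ L → ¬ LinAvoidsAll Λ L
¬LinAvoidsAll-Λ {π = π} π∈ f f1<f2 f2<f3 sub lin =
  All.lookup lin π∈ (Contains-map-increasing f π (λ c∈ d∈ → increasing (values π∈ c∈) (values π∈ d∈)) sub)
  where
  values : ∀ {π c} → π ∈ Λ → c ∈ π → c ∈ 1 ∷ 2 ∷ 3 ∷ []
  values π∈ = All.lookup (All.lookup (from-yes (All.all? (All.all? λ c → Any.any? (c ℕP.≟_) (1 ∷ 2 ∷ 3 ∷ [])) Λ)) π∈)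
  increasing : ∀ {c d} → c ∈ 1 ∷ 2 ∷ 3 ∷ [] → d ∈ 1 ∷ 2 ∷ 3 ∷ [] → c < d → f c < f d
  increasing (here refl)               (there (here refl))         _ = f1<f2
  increasing (here refl)               (there (there (here refl))) _ = ℕP.<-trans f1<f2 f2<f3
  increasing (there (here refl))       (there (there (here refl))) _ = f2<f3
  increasing (here refl)               (here refl)                 c<d = ⊥-elim (ℕP.<-irrefl refl c<d)
  increasing (there (here refl))       (there (here refl))         c<d = ⊥-elim (ℕP.<-irrefl refl c<d)
  increasing (there (there (here refl))) (there (there (here refl))) c<d = ⊥-elim (ℕP.<-irrefl refl c<d)
  increasing (there (here refl))       (here refl)                 (s≤s ())
  increasing (there (there (here refl))) (here refl)               (s≤s ())
  increasing (there (there (here refl))) (there (here refl))       (s≤s (s≤s ()))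

Contains-same-length⇒OrderIso : ∀ {σ π} → length σ ≡ length π → Contains σ π → OrderIso σ π
Contains-same-length⇒OrderIso l (s , sub , iso) with refl ← ≋⇒≡ (⊆P.to-≋ (trans (proj₁ iso) (sym l)) sub) = iso

LinAvoidsAll-Λ-length3 : All (LinAvoidsAll Λ) ((2 ∷ 1 ∷ 0 ∷ []) ∷ (2 ∷ 0 ∷ 1 ∷ []) ∷ (1 ∷ 2 ∷ 0 ∷ []) ∷ [])
LinAvoidsAll-Λ-length3 =
    (refute p₁ p₀ ∷ refute p₁ p₀ ∷ refute p₂ p₀ ∷ [])
  ∷ (refute p₁ p₀ ∷ refute p₁ p₀ ∷ refute p₂ p₀ ∷ [])
  ∷ (refute p₂ p₀ ∷ refute p₂ p₀ ∷ refute p₀ p₁ ∷ [])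
  ∷ []
  where
  refute : ∀ {σ π a b c d} {a<b : True (a <? b)} {d≤c : True (d ≤? c)} {l : True (length σ ℕP.≟ length π)} →
           (a , c) ∈ zip σ π → (b , d) ∈ zip σ π → ¬ Contains σ π
  refute {a<b = a<b} {d≤c} {l} m₁ m₂ c =
    ℕP.≤⇒≯ (toWitness d≤c) (Equivalence.to (proj₂ (Contains-same-length⇒OrderIso (toWitness l) c) m₁ m₂) (toWitness a<b))
  p₀ : ∀ {A : Set} {x y z : A} → x ∈ x ∷ y ∷ z ∷ []
  p₀ = here refl
  p₁ : ∀ {A : Set} {x y z : A} → y ∈ x ∷ y ∷ z ∷ []
  p₁ = there (here refl)
  p₂ : ∀ {A : Set} {x y z : A} → z ∈ x ∷ y ∷ z ∷ []
  p₂ = there (there (here refl))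

representatives : ℕ → List (List ℕ)
representatives 0 = [ [] ]
representatives 1 = [ 0 ∷ [] ]
representatives 2 = [ 1 ∷ 0 ∷ [] ]
representatives 3 = (2 ∷ 1 ∷ 0 ∷ []) ∷ (2 ∷ 0 ∷ 1 ∷ []) ∷ []
representatives 4 = map (3 ∷_) ((2 ∷ 1 ∷ 0 ∷ []) ∷ (2 ∷ 0 ∷ 1 ∷ []) ∷ (1 ∷ 2 ∷ 0 ∷ []) ∷ [])
representatives (suc n@(suc (suc (suc (suc _))))) = map (n ∷_) (representatives n)

length-representatives : ∀ k → length (representatives (4 + k)) ≡ 3
length-representatives zero    = refl
length-representatives (suc k) = trans (LP.length-map _ (representatives (4 + k))) (length-representatives k)

representatives-IsPerm : ∀ n → All (IsPerm n) (representatives n)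
representatives-IsPerm 0 = ↭-refl ∷ []
representatives-IsPerm 1 = ↭-refl ∷ []
representatives-IsPerm 2 = IsPerm-∷ ↭-refl ∷ []
representatives-IsPerm 3 = IsPerm-∷ (IsPerm-∷ ↭-refl) ∷ IsPerm-∷ ↭-refl ∷ []
representatives-IsPerm 4 =
  IsPerm-∷ (IsPerm-∷ (IsPerm-∷ ↭-refl)) ∷ IsPerm-∷ (IsPerm-∷ ↭-refl) ∷
  IsPerm-∷ (↭-trans (prep 1 (swap 2 0 ↭-refl)) (swap 1 0 ↭-refl)) ∷ []
representatives-IsPerm (suc n@(suc (suc (suc (suc _))))) = AllP.map⁺ (All.map IsPerm-∷ (representatives-IsPerm n))

representatives-shape : ∀ k {R} → R ∈ representatives (4 + k) →
  ∃₂ λ y ρ → ∃ λ d → R ≡ (3 + k) ∷ y ∷ ρ ++ [ d ] × d < y × y < 3 + k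
representatives-shape zero (here refl)                 = 2 , [ 1 ] , 0 , refl , <-lit , <-lit
representatives-shape zero (there (here refl))         = 2 , [ 0 ] , 1 , refl , <-lit , <-lit
representatives-shape zero (there (there (here refl))) = 1 , [ 2 ] , 0 , refl , <-lit , <-lit
representatives-shape (suc k) R∈
  with R₀ , R₀∈ , refl ← ∈P.∈-map⁻ _ R∈
  with y , ρ , d , refl , d<y , y<3+k ← representatives-shape k R₀∈ =
  3 + k , y ∷ ρ , d , refl , ℕP.<-trans d<y y<3+k , ℕP.n<1+n (3 + k)

CycAvoidsAll-short : ∀ {Π σ} → All (λ π → length σ < length π) Π → CycAvoidsAll Π σ
CycAvoidsAll-short = All.map (λ σ<π c → ℕP.<⇒≱ σ<π (CycContains-length c))

avoidsBoth-∷-max : ∀ {x τ} → All (_< x) τ → CycAvoidsAll (map (4 ∷_) Λ) τ → LinAvoidsAll Λ τ →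
  CycAvoidsAll (map (4 ∷_) Λ) (x ∷ τ) × LinAvoidsAll Λ (x ∷ τ)
avoidsBoth-∷-max τ<x avoid lin =
  Equivalence.from (CycAvoidsAll-∷-max τ<x Λ-bounded) (avoid , lin) , LinAvoidsAll-∷-max τ<x Λ-HeadNotMax lin

representatives-avoidBoth : ∀ k →
  All (λ R → CycAvoidsAll (map (4 ∷_) Λ) R × LinAvoidsAll Λ R) (representatives (4 + k))
representatives-avoidBoth zero with lin₂₁₀ ∷ lin₂₀₁ ∷ lin₁₂₀ ∷ [] ← LinAvoidsAll-Λ-length3 =
  prepend-3 lin₂₁₀ ∷ prepend-3 lin₂₀₁ ∷ prepend-3 lin₁₂₀ ∷ []
  where
  prepend-3 : ∀ {a b c} {bounded : True (All.all? (_<? 3) (a ∷ b ∷ c ∷ []))} →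
              LinAvoidsAll Λ (a ∷ b ∷ c ∷ []) →
              CycAvoidsAll (map (4 ∷_) Λ) (3 ∷ a ∷ b ∷ c ∷ []) × LinAvoidsAll Λ (3 ∷ a ∷ b ∷ c ∷ [])
  prepend-3 {bounded = bounded} =
    avoidsBoth-∷-max (toWitness bounded) (CycAvoidsAll-short (<-lit ∷ <-lit ∷ <-lit ∷ []))
representatives-avoidBoth (suc k) =
  AllP.map⁺ (All.zipWith (λ ((avoid , lin) , p) → avoidsBoth-∷-max (IsPerm-bounded p) avoid lin)
                         (representatives-avoidBoth k , representatives-IsPerm (4 + k)))

representatives-avoid : ∀ n → All (CycAvoidsAll (map (4 ∷_) Λ)) (representatives n)
representatives-avoid 0 = CycAvoidsAll-short (<-lit ∷ <-lit ∷ <-lit ∷ []) ∷ []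
representatives-avoid 1 = CycAvoidsAll-short (<-lit ∷ <-lit ∷ <-lit ∷ []) ∷ []
representatives-avoid 2 = CycAvoidsAll-short (<-lit ∷ <-lit ∷ <-lit ∷ []) ∷ []
representatives-avoid 3 =
  CycAvoidsAll-short (<-lit ∷ <-lit ∷ <-lit ∷ []) ∷ CycAvoidsAll-short (<-lit ∷ <-lit ∷ <-lit ∷ []) ∷ []
representatives-avoid (suc (suc (suc (suc k)))) = All.map proj₁ (representatives-avoidBoth k)

Unique-++⁻ʳ : ∀ xs {ys : List ℕ} → Unique (xs ++ ys) → Unique ys
Unique-++⁻ʳ []       u       = u
Unique-++⁻ʳ (_ ∷ xs) (_ ∷ u) = Unique-++⁻ʳ xs u

two-below-then-max : ∀ {d₁ d₂ x} rest more → d₁ ≢ d₂ → d₁ < x → d₂ < x →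
  ¬ LinAvoidsAll Λ (d₁ ∷ d₂ ∷ rest ++ x ∷ more)
two-below-then-max {d₁} {d₂} {x} rest more d₁≢d₂ d₁<x d₂<x = by-order (ℕP.<-cmp d₁ d₂)
  where
  sub : d₁ ∷ d₂ ∷ x ∷ [] ⊆ d₁ ∷ d₂ ∷ rest ++ x ∷ more
  sub = refl ∷ refl ∷ ⊆P.++⁺ˡ rest (refl ∷ ⊆P.[]⊆-universal more)
  by-order : Tri (d₁ < d₂) (d₁ ≡ d₂) (d₂ < d₁) → ¬ LinAvoidsAll Λ (d₁ ∷ d₂ ∷ rest ++ x ∷ more)
  by-order (tri< d₁<d₂ _ _) = ¬LinAvoidsAll-Λ (here refl) (λ { 1 → d₁ ; 2 → d₂ ; _ → x }) d₁<d₂ d₂<x sub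
  by-order (tri≈ _ d₁≡d₂ _) = λ _ → d₁≢d₂ d₁≡d₂
  by-order (tri> _ _ d₂<d₁) = ¬LinAvoidsAll-Λ (there (there (here refl))) (λ { 1 → d₂ ; 2 → d₁ ; _ → x }) d₂<d₁ d₁<x sub

-- In a rotation other than the identity the maximum x is preceded either by two smaller
-- entries (an occurrence of 123 or 213) or by the last entry d alone, and then d x y is a 132.
Rot-max-first-rigid : ∀ {x y ρ d σ} → Unique (y ∷ ρ ++ [ d ]) → All (_< x) (y ∷ ρ ++ [ d ]) → d < y →
  Rot (x ∷ y ∷ ρ ++ [ d ]) σ → LinAvoidsAll Λ σ → σ ≡ x ∷ y ∷ ρ ++ [ d ]
Rot-max-first-rigid _ _ _ ([] , v , eq , refl) _ = trans (LP.++-identityʳ v) (sym eq)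
Rot-max-first-rigid {x} {y} {ρ} {d} unique below d<y (_ ∷ u , v , eq , refl) lin
  with refl , tail≡ ← LP.∷-injective eq = rotated v tail≡ lin
  where
  rotated : ∀ v → y ∷ ρ ++ [ d ] ≡ u ++ v → LinAvoidsAll Λ (v ++ x ∷ u) → v ++ x ∷ u ≡ x ∷ y ∷ ρ ++ [ d ]
  rotated []                 tail≡ _   = cong (x ∷_) (sym (trans tail≡ (LP.++-identityʳ u)))
  rotated (d′ ∷ [])          tail≡ lin with refl , refl ← LP.∷ʳ-injective (y ∷ ρ) u tail≡ =
    ⊥-elim (¬LinAvoidsAll-Λ (there (here refl)) (λ { 1 → d ; 2 → y ; _ → x }) d<y (All.lookup below (here refl))
                            (refl ∷ refl ∷ refl ∷ ⊆P.[]⊆-universal ρ) lin)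
  rotated (d₁ ∷ d₂ ∷ v′) tail≡ lin =
    ⊥-elim (two-below-then-max v′ u d₁≢d₂ (All.lookup below′ (here refl)) (All.lookup below′ (there (here refl))) lin)
    where
    below′ : All (_< x) (d₁ ∷ d₂ ∷ v′)
    below′ = AllP.++⁻ʳ u (subst (All (_< x)) tail≡ below)
    d₁≢d₂ : d₁ ≢ d₂
    d₁≢d₂ with (d₁≢d₂ ∷ _) ∷ _ ← Unique-++⁻ʳ u (subst Unique tail≡ unique) = d₁≢d₂

representatives-extend : ∀ n {R τ} → R ∈ representatives n → Rot R τ → LinAvoidsAll Λ τ →
  Any (λ R′ → Rot R′ (n ∷ τ)) (representatives (suc n))
representatives-extend 0 (here refl) r lin with Rot⇒∈-rotations r
... | here refl = here (Rot-refl _)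
representatives-extend 1 (here refl) r lin with Rot⇒∈-rotations r
... | here refl         = here (Rot-refl _)
... | there (here refl) = here (Rot-refl _)
representatives-extend 2 (here refl) r lin with Rot⇒∈-rotations r
... | here refl                 = here (Rot-refl _)
... | there (here refl)         = there (here (Rot-refl _))
... | there (there (here refl)) = here (Rot-refl _)
representatives-extend 3 (here refl) r lin with Rot⇒∈-rotations r
... | here refl                         = here (Rot-refl _)
... | there (here refl)                 = ⊥-elim (¬LinAvoidsAll-Λ (there (there (here refl))) pred <-lit <-lit ⊆-refl lin)
... | there (there (here refl))         = ⊥-elim (¬LinAvoidsAll-Λ (there (here refl)) pred <-lit <-lit ⊆-refl lin)
... | there (there (there (here refl))) = here (Rot-refl _)
representatives-extend 3 (there (here refl)) r lin with Rot⇒∈-rotations r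
... | here refl                         = there (here (Rot-refl _))
... | there (here refl)                 = ⊥-elim (¬LinAvoidsAll-Λ (here refl) pred <-lit <-lit ⊆-refl lin)
... | there (there (here refl))         = there (there (here (Rot-refl _)))
... | there (there (there (here refl))) = there (here (Rot-refl _))
representatives-extend (suc (suc (suc (suc k)))) R∈ r lin
  with y , ρ , d , refl , d<y , _ ← representatives-shape k R∈
  with p ← IsPerm-∷⁻ (All.lookup (representatives-IsPerm (4 + k)) R∈)
  with refl ← Rot-max-first-rigid (IsPerm-unique p) (IsPerm-bounded p) d<y r lin =
  AnyP.map⁺ (Any.map (λ { refl → Rot-refl _ }) R∈)

representatives-complete : ∀ n {σ} → IsPerm n σ → CycAvoidsAll (map (4 ∷_) Λ) σ →
  Any (λ R → Rot R σ) (representatives n)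
representatives-complete zero p _ with refl ← ↭P.↭-empty-inv p = here (Rot-refl [])
representatives-complete (suc n) p avoid
  with τ , r , pτ ← IsPerm-rotate-max-first p
  with avoidτ , linτ ← Equivalence.to (CycAvoidsAll-∷-max (IsPerm-bounded pτ) Λ-bounded) (CycAvoidsAll-resp-Rot r avoid)
  with _ , R∈ , rR ← find (representatives-complete n pτ avoidτ) =
  Any.map (λ r′ → Rot-trans r′ (Rot-sym r)) (representatives-extend n R∈ rR linτ)

¬RotEq-∷-max : ∀ {n σ τ} → All (_< n) τ → RotDistinct σ τ → RotDistinct (n ∷ σ) (n ∷ τ)
¬RotEq-∷-max {n} {σ} {τ} τ<n ¬e e = split (RotEq⇒Rot e)
  where
  shifted : ∀ u v → τ ≡ u ++ v → n ∷ σ ≡ v ++ n ∷ u → ⊥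
  shifted u []      τ≡ eq′ = ¬e (Rot⇒RotEq (u , [] , τ≡ , LP.∷-injectiveʳ eq′))
  shifted u (b ∷ v) τ≡ eq′ with refl , _ ← LP.∷-injective eq′ =
    ℕP.<-irrefl refl (All.lookup τ<n (subst (n ∈_) (sym τ≡) (∈P.∈-++⁺ʳ u (here refl))))
  split : Rot (n ∷ τ) (n ∷ σ) → ⊥
  split ([] , _ , refl , eq′) = ¬e (Rot⇒RotEq ([] , τ , refl , LP.∷-injectiveʳ eq′))
  split (_ ∷ u , v , eq , eq′) with refl , τ≡ ← LP.∷-injective eq = shifted u v τ≡ eq′

AllPairs-RotDistinct-∷-max : ∀ n {rs} → All (All (_< n)) rs → AllPairs RotDistinct rs →
  AllPairs RotDistinct (map (n ∷_) rs)
AllPairs-RotDistinct-∷-max n []             []          = []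
AllPairs-RotDistinct-∷-max n (_ ∷ bounded) (¬es ∷ ps) =
  AllP.map⁺ (All.zipWith (λ (¬e , τ<n) → ¬RotEq-∷-max τ<n ¬e) (¬es , bounded))
  ∷ AllPairs-RotDistinct-∷-max n bounded ps

representatives-distinct : ∀ n → AllPairs RotDistinct (representatives n)
representatives-distinct 0 = from-yes (allPairs? RotDistinct? (representatives 0))
representatives-distinct 1 = from-yes (allPairs? RotDistinct? (representatives 1))
representatives-distinct 2 = from-yes (allPairs? RotDistinct? (representatives 2))
representatives-distinct 3 = from-yes (allPairs? RotDistinct? (representatives 3))
representatives-distinct 4 = from-yes (allPairs? RotDistinct? (representatives 4))
representatives-distinct (suc n@(suc (suc (suc (suc _))))) =
  AllPairs-RotDistinct-∷-max n (All.map IsPerm-bounded (representatives-IsPerm n)) (representatives-distinct n)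

CountAv-Π₂ : ∀ n → CountAv n Π₂ (length (representatives n))
CountAv-Π₂ n =
  representatives n , refl ,
  All.zipWith (λ (p , avoid) → p , CycAvoidsAll-rotate-patterns (from-yes (Covers? id (map (4 ∷_) Λ) Π₂)) avoid)
              (representatives-IsPerm n , representatives-avoid n) ,
  representatives-distinct n ,
  λ σ p avoid → Any.map Rot⇒RotEq
    (representatives-complete n p (CycAvoidsAll-rotate-patterns (from-yes (Covers? id Π₂ (map (4 ∷_) Λ))) avoid))

-- The other three classes, by symmetry

All-≤? : ∀ b (Π : List (List ℕ)) → Dec (All (All (_≤ b)) Π)
All-≤? b = All.all? (All.all? (_≤? b))

CountAv-Π₃ : ∀ n → CountAv n Π₃ (length (representatives n))
CountAv-Π₃ n = CountAv-reverse (from-yes (Covers? reverse Π₂ Π₃)) (from-yes (Covers? reverse Π₃ Π₂)) (CountAv-Π₂ n)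

-- Pattern entries lie in 1…4, so 5 ∸_ is their complement.
CountAv-Π₄ : ∀ n → CountAv n Π₄ (length (representatives n))
CountAv-Π₄ n = CountAv-complement 5 (from-yes (All-≤? 5 Π₂)) (from-yes (All-≤? 5 Π₄))
  (from-yes (Covers? (map (5 ∸_)) Π₂ Π₄)) (from-yes (Covers? (map (5 ∸_)) Π₄ Π₂)) (CountAv-Π₂ n)

CountAv-Π₁ : ∀ n → CountAv n Π₁ (length (representatives n))
CountAv-Π₁ n = CountAv-complement 5 (from-yes (All-≤? 5 Π₃)) (from-yes (All-≤? 5 Π₁))
  (from-yes (Covers? (map (5 ∸_)) Π₃ Π₁)) (from-yes (Covers? (map (5 ∸_)) Π₁ Π₃)) (CountAv-Π₃ n)

mainTheorem9 :
    ((n : ℕ) → ∃ λ m →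
        CountAv n ((1 ∷ 2 ∷ 3 ∷ 4 ∷ []) ∷ (1 ∷ 2 ∷ 4 ∷ 3 ∷ []) ∷ (1 ∷ 3 ∷ 2 ∷ 4 ∷ []) ∷ []) m
      × CountAv n ((1 ∷ 2 ∷ 3 ∷ 4 ∷ []) ∷ (1 ∷ 3 ∷ 2 ∷ 4 ∷ []) ∷ (1 ∷ 3 ∷ 4 ∷ 2 ∷ []) ∷ []) m
      × CountAv n ((1 ∷ 2 ∷ 4 ∷ 3 ∷ []) ∷ (1 ∷ 4 ∷ 2 ∷ 3 ∷ []) ∷ (1 ∷ 4 ∷ 3 ∷ 2 ∷ []) ∷ []) m
      × CountAv n ((1 ∷ 3 ∷ 4 ∷ 2 ∷ []) ∷ (1 ∷ 4 ∷ 2 ∷ 3 ∷ []) ∷ (1 ∷ 4 ∷ 3 ∷ 2 ∷ []) ∷ []) m)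
    × ((n : ℕ) → n ≥ 4 →
        CountAv n ((1 ∷ 2 ∷ 3 ∷ 4 ∷ []) ∷ (1 ∷ 3 ∷ 2 ∷ 4 ∷ []) ∷ (1 ∷ 3 ∷ 4 ∷ 2 ∷ []) ∷ []) 3)
mainTheorem9 =
  (λ n → length (representatives n) , CountAv-Π₁ n , CountAv-Π₂ n , CountAv-Π₃ n , CountAv-Π₄ n) , three
  where
  three : ∀ n → n ≥ 4 → CountAv n Π₂ 3
  three n n≥4 with k , refl ← ℕP.m≤n⇒∃[o]m+o≡n n≥4 =
    subst (CountAv (4 + k) Π₂) (length-representatives k) (CountAv-Π₂ (4 + k))
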